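{- Let $D$ be a finite digraph. (a) If every vertex of $D$ has out-degree at most $\Delta$, then there exists a set $A\subseteq V(D)$ such that the induced subdigraph $D[A]$ is acyclic and $|A|\ge\frac{|V(D)|}{\Delta+1}$. (b) There exists a maximal independent set $S$ of $D$ with $|N^+[S]|\ge\frac{1}{2}|V(D)|$.
   Context: A digraph is acyclic if it contains no directed cycles. A set is independent if there are no arcs between two of its vertices; it is a maximal independent set if $S\cup\{v\}$ is not independent for every $v\notin S$. For $S\subseteq V(D)$, $N^+[S]=S\cup\{v:\exists u\in S,\ uv\in E(D)\}$. -}

module Defs where

open import Data.Nat using (ℕ; zero; suc)
open import Data.Bool using (Bool; true; false; _∨_; _∧_)
open import Data.Fin using (Fin; zero; suc; inject₁; fromℕ)
open import Data.Fin.Subset using (Subset; _∈_; _∉_; _∪_; ⁅_⁆; ∣_∣)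
open import Data.Vec using (tabulate; lookup)
open import Data.Product using (Σ; ∃; _×_; _,_)
open import Data.Empty using (⊥)
open import Relation.Nullary using (¬_)
open import Relation.Binary.PropositionalEquality using (_≡_)
open import Function.Definitions using (Injective)

record Digraph (n : ℕ) : Set where
  field
    arc      : Fin n → Fin n → Bool
    loopless : ∀ v → arc v v ≡ false
open Digraph public

outNbrs : ∀ {n} → Digraph n → Fin n → Subset n
outNbrs D u = tabulate (arc D u)

outdeg : ∀ {n} → Digraph n → Fin n → ℕ
outdeg D u = ∣ outNbrs D u ∣

record DirCycle {n : ℕ} (D : Digraph n) : Set where
  field
    k      : ℕ
    vtx    : Fin (suc k) → Fin n
    inj    : Injective _≡_ _≡_ vtx
    step   : ∀ (i : Fin k) → arc D (vtx (inject₁ i)) (vtx (suc i)) ≡ true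
    close  : arc D (vtx (fromℕ k)) (vtx zero) ≡ true
open DirCycle public

InducedAcyclic : ∀ {n} → Digraph n → Subset n → Set
InducedAcyclic D A = (C : DirCycle D) → ¬ (∀ i → vtx C i ∈ A)

Independent : ∀ {n} → Digraph n → Subset n → Set
Independent D S = ∀ u v → u ∈ S → v ∈ S → arc D u v ≡ false

MaximalIndependent : ∀ {n} → Digraph n → Subset n → Set
MaximalIndependent D S =
  Independent D S × (∀ v → v ∉ S → ¬ Independent D (S ∪ ⁅ v ⁆))

anyFin : ∀ {n} → (Fin n → Bool) → Bool
anyFin {zero}  f = false
anyFin {suc n} f = f zero ∨ anyFin (λ i → f (suc i))

closedOutNbhd : ∀ {n} → Digraph n → Subset n → Subset n
closedOutNbhd D S =
  tabulate (λ v → lookup S v ∨ anyFin (λ u → lookup S u ∧ arc D u v))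

module Submission where

-- Both parts are greedy on the set R of vertices not yet discarded.
-- (a) Pick v ∈ R, put it into A and discard N⁺[v]; at most Δ + 1 vertices
-- leave R per vertex of A. A vertex chosen later is never an out-neighbour of
-- one chosen earlier, so ranking A by the order of choice makes every arc of
-- D[A] go down in rank, and D[A] is acyclic.
-- (b) Counting the arcs of D[R] by tails and by heads gives a v ∈ R whose
-- in-degree in D[R] is at most its out-degree d. Put v into S and discard v
-- with all its in- and out-neighbours: at most 1 + 2d vertices leave R, while
-- the 1 + d vertices of N⁺[v] ∩ R enter N⁺[S]. Every discarded vertex is
-- adjacent to v, so the resulting independent set is maximal.

open import Defs
open import Data.Bool using (Bool; true; false; _∧_; _∨_)
open import Data.Bool.Properties using (∨-zeroʳ)
open import Data.Fin using (Fin; zero; suc; inject₁; fromℕ; _≟_)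
open import Data.Fin.Subset
open import Data.Fin.Subset.Induction using (⊂-wellFounded)
open import Data.Fin.Subset.Properties
open import Data.Nat using (ℕ; zero; suc; _≤_; _<_; _*_; _+_; z≤n; s≤s; _<?_)
open import Data.Nat.Properties
  using ( ≤-refl; ≤-reflexive; ≤-trans; <⇒≤; <⇒≱; ≤-<-trans; <-≤-trans; ≮⇒≥; n≮0
        ; m<1+n⇒m≤n; m<n+m; +-suc; +-comm; +-identityʳ; *-suc; *-distribˡ-+
        ; +-mono-≤; +-monoˡ-≤; +-monoʳ-≤; *-monoʳ-≤; +-cancelˡ-<
        ; +-0-commutativeMonoid; module ≤-Reasoning)
open import Data.Product using (Σ; ∃; _×_; _,_; proj₁; proj₂)
open import Data.Sum using (_⊎_; inj₁; inj₂)
open import Data.Vec using ([]; _∷_; here; there; tabulate; lookup)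
open import Data.Vec.Properties using (lookup∘tabulate; lookup-zipWith; []=⇒lookup; lookup⇒[]=)
open import Function using (_∘_; id; case_of_)
open import Induction.WellFounded using (module All)
open import Level using (0ℓ)
open import Relation.Nullary using (yes; no; contradiction)
open import Relation.Binary.PropositionalEquality
open import Algebra.Properties.CommutativeMonoid.Sum +-0-commutativeMonoid
  using (sum-syntax; ∑-comm; ∑-distrib-+; sum-replicate-zero; sum-cong-≗)

private variable n : ℕ

∣p∣≡∣p─q∣+∣p∩q∣ : (p q : Subset n) → ∣ p ∣ ≡ ∣ p ─ q ∣ + ∣ p ∩ q ∣
∣p∣≡∣p─q∣+∣p∩q∣ []            []            = refl
∣p∣≡∣p─q∣+∣p∩q∣ (outside ∷ p) (outside ∷ q) = ∣p∣≡∣p─q∣+∣p∩q∣ p q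
∣p∣≡∣p─q∣+∣p∩q∣ (outside ∷ p) (inside  ∷ q) = ∣p∣≡∣p─q∣+∣p∩q∣ p q
∣p∣≡∣p─q∣+∣p∩q∣ (inside  ∷ p) (outside ∷ q) = cong suc (∣p∣≡∣p─q∣+∣p∩q∣ p q)
∣p∣≡∣p─q∣+∣p∩q∣ (inside  ∷ p) (inside  ∷ q) =
  trans (cong suc (∣p∣≡∣p─q∣+∣p∩q∣ p q)) (sym (+-suc _ _))

∣p∪q∣≤∣p∣+∣q∣ : (p q : Subset n) → ∣ p ∪ q ∣ ≤ ∣ p ∣ + ∣ q ∣
∣p∪q∣≤∣p∣+∣q∣ []            []            = z≤n
∣p∪q∣≤∣p∣+∣q∣ (outside ∷ p) (outside ∷ q) = ∣p∪q∣≤∣p∣+∣q∣ p q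
∣p∪q∣≤∣p∣+∣q∣ (outside ∷ p) (inside  ∷ q) =
  subst (suc ∣ p ∪ q ∣ ≤_) (sym (+-suc _ _)) (s≤s (∣p∪q∣≤∣p∣+∣q∣ p q))
∣p∪q∣≤∣p∣+∣q∣ (inside  ∷ p) (t       ∷ q) =
  s≤s (≤-trans (∣p∪q∣≤∣p∣+∣q∣ p q) (+-monoʳ-≤ ∣ p ∣ (∣p∣≤∣x∷p∣ t q)))

x∈p─q⇒x∉q : ∀ {x : Fin n} {p q} → x ∈ p ─ q → x ∉ q
x∈p─q⇒x∉q {p = _ ∷ p} {outside ∷ q} (there x∈) (there x∈q) = x∈p─q⇒x∉q x∈ x∈q
x∈p─q⇒x∉q {p = inside ∷ p} {outside ∷ q} here ()
x∈p─q⇒x∉q {p = _ ∷ p} {inside ∷ q} (there x∈) (there x∈q) = x∈p─q⇒x∉q x∈ x∈q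

x∈p∪⁅y⁆⁻ : ∀ {x y : Fin n} {p} → x ∈ p ∪ ⁅ y ⁆ → x ∈ p ⊎ x ≡ y
x∈p∪⁅y⁆⁻ {y = y} {p} x∈ with x∈p∪q⁻ p ⁅ y ⁆ x∈
... | inj₁ x∈p = inj₁ x∈p
... | inj₂ x∈y = inj₂ (x∈⁅y⁆⇒x≡y y x∈y)

p∪⁅y⁆⊆r : ∀ {y : Fin n} {p r} → p ⊆ r → y ∈ r → p ∪ ⁅ y ⁆ ⊆ r
p∪⁅y⁆⊆r p⊆r y∈r x∈ with x∈p∪⁅y⁆⁻ x∈
... | inj₁ x∈p  = p⊆r x∈p
... | inj₂ refl = y∈r

∈-tabulate⁺ : ∀ {f : Fin n → Bool} {x} → f x ≡ true → x ∈ tabulate f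
∈-tabulate⁺ {f = f} {x} fx = lookup⇒[]= x (tabulate f) (trans (lookup∘tabulate f x) fx)

∈-tabulate⁻ : ∀ {f : Fin n → Bool} {x} → x ∈ tabulate f → f x ≡ true
∈-tabulate⁻ {f = f} {x} x∈ = trans (sym (lookup∘tabulate f x)) ([]=⇒lookup x∈)

x∉p⇒lookup≡false : ∀ {x : Fin n} {p} → x ∉ p → lookup p x ≡ false
x∉p⇒lookup≡false {x = x} {p} x∉p with lookup p x in px
... | true  = contradiction (lookup⇒[]= x p px) x∉p
... | false = refl

x∉tabulate⇒false : ∀ {f : Fin n → Bool} {x} → x ∉ tabulate f → f x ≡ false
x∉tabulate⇒false {f = f} {x} x∉ = trans (sym (lookup∘tabulate f x)) (x∉p⇒lookup≡false x∉)

x∉p⇒∣p∣<∣p∪⁅x⁆∣ : ∀ {x : Fin n} {p} → x ∉ p → ∣ p ∣ < ∣ p ∪ ⁅ x ⁆ ∣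
x∉p⇒∣p∣<∣p∪⁅x⁆∣ {x = x} x∉p = p⊂q⇒∣p∣<∣q∣ (p⊆p∪q ⁅ x ⁆ , x , x∈p∪q⁺ (inj₂ (x∈⁅x⁆ x)) , x∉p)

𝟙 : Bool → ℕ
𝟙 true  = 1
𝟙 false = 0

∣p∣≡∑𝟙 : (p : Subset n) → ∣ p ∣ ≡ ∑[ i < n ] 𝟙 (lookup p i)
∣p∣≡∑𝟙 []            = refl
∣p∣≡∑𝟙 (outside ∷ p) = ∣p∣≡∑𝟙 p
∣p∣≡∑𝟙 (inside  ∷ p) = cong suc (∣p∣≡∑𝟙 p)

∑-<⇒∃-< : (f g : Fin n → ℕ) → ∑[ i < n ] g i < ∑[ i < n ] f i → ∃ λ i → g i < f i
∑-<⇒∃-< {zero}  f g ()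
∑-<⇒∃-< {suc n} f g ∑g<∑f with g zero <? f zero
... | yes g₀<f₀ = zero , g₀<f₀
... | no  g₀≮f₀ = let i , gᵢ<fᵢ = ∑-<⇒∃-< (f ∘ suc) (g ∘ suc) tail< in suc i , gᵢ<fᵢ
  where
  tail< : ∑[ i < n ] g (suc i) < ∑[ i < n ] f (suc i)
  tail< = +-cancelˡ-< (f zero) _ _ (≤-<-trans (+-monoˡ-≤ _ (≮⇒≥ g₀≮f₀)) ∑g<∑f)

x∈p⇒0<∣p∣ : ∀ {x : Fin n} {p} → x ∈ p → 0 < ∣ p ∣
x∈p⇒0<∣p∣ here                    = s≤s z≤n
x∈p⇒0<∣p∣ {p = s ∷ p} (there x∈p) = <-≤-trans (x∈p⇒0<∣p∣ x∈p) (∣p∣≤∣x∷p∣ s p)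

∧-≡true⁻ : ∀ {x y} → x ∧ y ≡ true → x ≡ true × y ≡ true
∧-≡true⁻ {true} y≡true = refl , y≡true

anyFin⁺ : ∀ (f : Fin n → Bool) {i} → f i ≡ true → anyFin f ≡ true
anyFin⁺ f {zero}  fi rewrite fi = refl
anyFin⁺ f {suc i} fi rewrite anyFin⁺ (f ∘ suc) fi = ∨-zeroʳ (f zero)

anyFin⁻ : ∀ (f : Fin n → Bool) → anyFin f ≡ true → ∃ λ i → f i ≡ true
anyFin⁻ {suc n} f any with f zero in f₀
... | true  = zero , f₀
... | false = let i , fi = anyFin⁻ (f ∘ suc) any in suc i , fi

∩-mono-⊆ : ∀ {p p′ q q′ : Subset n} → p ⊆ p′ → q ⊆ q′ → p ∩ q ⊆ p′ ∩ q′
∩-mono-⊆ {p = p} {q = q} p⊆p′ q⊆q′ x∈p∩q =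
  let x∈p , x∈q = x∈p∩q⁻ p q x∈p∩q in x∈p∩q⁺ (p⊆p′ x∈p , q⊆q′ x∈q)

Empty⇒∣p∣≡0 : ∀ {p : Subset n} → Empty p → ∣ p ∣ ≡ 0
Empty⇒∣p∣≡0 {n} p-empty = trans (cong ∣_∣ (Empty-unique p-empty)) (∣⊥∣≡0 n)

true≢false : true ≢ false
true≢false ()

module _ (D : Digraph n) where

  closedOutNbr : Fin n → Subset n
  closedOutNbr v = ⁅ v ⁆ ∪ outNbrs D v

  Ranked : Subset n → Set
  Ranked A = Σ (Fin n → ℕ) λ r →
    ∀ {u w} → u ∈ A → w ∈ A → arc D u w ≡ true → r w < r u

  descending⇒last≤first : ∀ k (g : Fin (suc k) → ℕ) →
    (∀ (i : Fin k) → g (suc i) < g (inject₁ i)) → g (fromℕ k) ≤ g zero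
  descending⇒last≤first zero    g desc = ≤-refl
  descending⇒last≤first (suc k) g desc = ≤-trans (<⇒≤ (desc (fromℕ k)))
    (descending⇒last≤first k (g ∘ inject₁) (desc ∘ inject₁))

  ranked⇒acyclic : ∀ {A} → Ranked A → InducedAcyclic D A
  ranked⇒acyclic (r , desc) C inA = <⇒≱ (desc (inA _) (inA zero) (close C))
    (descending⇒last≤first (k C) (r ∘ vtx C) (λ i → desc (inA _) (inA _) (step C i)))

  ranked-∪-sink : ∀ {A v} → Ranked A → (∀ {w} → w ∈ A → arc D v w ≡ false) →
                  Ranked (A ∪ ⁅ v ⁆)
  ranked-∪-sink {A} {v} (r , desc) sink = rank , rank-desc
    where
    rank : Fin n → ℕ
    rank w with w ≟ v
    ... | yes _ = 0
    ... | no  _ = suc (r w)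
    inA : ∀ {x} → x ∈ A ∪ ⁅ v ⁆ → x ≢ v → x ∈ A
    inA x∈ x≢v with x∈p∪⁅y⁆⁻ x∈
    ... | inj₁ x∈A = x∈A
    ... | inj₂ x≡v = contradiction x≡v x≢v
    rank-desc : ∀ {u w} → u ∈ A ∪ ⁅ v ⁆ → w ∈ A ∪ ⁅ v ⁆ → arc D u w ≡ true → rank w < rank u
    rank-desc {u} {w} u∈ w∈ u→w with u ≟ v | w ≟ v
    ... | yes refl | yes refl = contradiction (trans (sym u→w) (loopless D u)) true≢false
    ... | yes refl | no w≢v   = contradiction (trans (sym u→w) (sink (inA w∈ w≢v))) true≢false
    ... | no _     | yes _    = s≤s z≤n
    ... | no u≢v   | no w≢v   = s≤s (desc (inA u∈ u≢v) (inA w∈ w≢v) u→w)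

  module _ {Δ : ℕ} (bounded : ∀ v → outdeg D v ≤ Δ) where

    ∣closedOutNbr∣≤1+Δ : ∀ v → ∣ closedOutNbr v ∣ ≤ suc Δ
    ∣closedOutNbr∣≤1+Δ v = begin
      ∣ ⁅ v ⁆ ∪ outNbrs D v ∣      ≤⟨ ∣p∪q∣≤∣p∣+∣q∣ ⁅ v ⁆ (outNbrs D v) ⟩
      ∣ ⁅ v ⁆ ∣ + outdeg D v       ≤⟨ +-mono-≤ (≤-reflexive (∣⁅x⁆∣≡1 v)) (bounded v) ⟩
      suc Δ                        ∎
      where open ≤-Reasoning

    LargeRankedSubset : Subset n → Set
    LargeRankedSubset R = Σ (Subset n) λ A → A ⊆ R × Ranked A × ∣ R ∣ ≤ suc Δ * ∣ A ∣

    largeRankedSubset : ∀ R → LargeRankedSubset R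
    largeRankedSubset = All.wfRec ⊂-wellFounded 0ℓ LargeRankedSubset greedy
      where
      greedy : ∀ R → (∀ {R'} → R' ⊂ R → LargeRankedSubset R') → LargeRankedSubset R
      greedy R rec with nonempty? R
      ... | no R-empty =
        ⊥ , ⊆-min R , ((λ _ → 0) , λ u∈⊥ → contradiction u∈⊥ ∉⊥) ,
        ≤-trans (≤-reflexive (Empty⇒∣p∣≡0 R-empty)) z≤n
      ... | yes (v , v∈R) with rec (p∩q≢∅⇒p─q⊂p R (closedOutNbr v) (v , x∈p∩q⁺ (v∈R , v∈N⁺[v])))
        where v∈N⁺[v] = x∈p∪q⁺ (inj₁ (x∈⁅x⁆ v))
      ... | A' , A'⊆R' , ranked' , large' = A , A⊆R , ranked , large
        where
        N⁺[v] = closedOutNbr v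
        R' = R ─ N⁺[v]
        A = A' ∪ ⁅ v ⁆
        A'∉N⁺[v] : ∀ {w} → w ∈ A' → w ∉ N⁺[v]
        A'∉N⁺[v] w∈A' = x∈p─q⇒x∉q (A'⊆R' w∈A')
        v∉A' : v ∉ A'
        v∉A' v∈A' = A'∉N⁺[v] v∈A' (x∈p∪q⁺ (inj₁ (x∈⁅x⁆ v)))
        A⊆R : A ⊆ R
        A⊆R = p∪⁅y⁆⊆r (p─q⊆p R N⁺[v] ∘ A'⊆R') v∈R
        ranked : Ranked A
        ranked = ranked-∪-sink ranked'
          (λ w∈A' → x∉tabulate⇒false (A'∉N⁺[v] w∈A' ∘ q⊆p∪q ⁅ v ⁆ (outNbrs D v)))
        large : ∣ R ∣ ≤ suc Δ * ∣ A ∣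
        large = begin
          ∣ R ∣                              ≡⟨ ∣p∣≡∣p─q∣+∣p∩q∣ R N⁺[v] ⟩
          ∣ R' ∣ + ∣ R ∩ N⁺[v] ∣            ≤⟨ +-mono-≤ large' (≤-trans (∣p∩q∣≤∣q∣ R N⁺[v]) (∣closedOutNbr∣≤1+Δ v)) ⟩
          suc Δ * ∣ A' ∣ + suc Δ             ≡⟨ +-comm (suc Δ * ∣ A' ∣) (suc Δ) ⟩
          suc Δ + suc Δ * ∣ A' ∣             ≡⟨ *-suc (suc Δ) ∣ A' ∣ ⟨
          suc Δ * suc ∣ A' ∣                 ≤⟨ *-monoʳ-≤ (suc Δ) (x∉p⇒∣p∣<∣p∪⁅x⁆∣ v∉A') ⟩
          suc Δ * ∣ A ∣                      ∎
          where open ≤-Reasoning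

  inNbrs : Fin n → Subset n
  inNbrs v = tabulate (λ u → arc D u v)

  module _ (R : Subset n) where

    arc𝟙 : Fin n → Fin n → ℕ
    arc𝟙 u w = 𝟙 (lookup R u ∧ lookup R w ∧ arc D u w)

    rowSum colSum : Fin n → ℕ
    rowSum v = ∑[ w < n ] arc𝟙 v w
    colSum w = ∑[ u < n ] arc𝟙 u w

    ∣R∩outNbrs∣≡rowSum : ∀ {v} → lookup R v ≡ true → ∣ R ∩ outNbrs D v ∣ ≡ rowSum v
    ∣R∩outNbrs∣≡rowSum {v} Rv = trans (∣p∣≡∑𝟙 (R ∩ outNbrs D v)) (sum-cong-≗ λ w → cong 𝟙 (begin
      lookup (R ∩ outNbrs D v) w            ≡⟨ lookup-zipWith _∧_ w R (outNbrs D v) ⟩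
      lookup R w ∧ lookup (outNbrs D v) w   ≡⟨ cong (lookup R w ∧_) (lookup∘tabulate (arc D v) w) ⟩
      lookup R w ∧ arc D v w                ≡⟨ cong (_∧ (lookup R w ∧ arc D v w)) Rv ⟨
      lookup R v ∧ lookup R w ∧ arc D v w   ∎))
      where open ≡-Reasoning

    ∣R∩inNbrs∣≡colSum : ∀ {v} → lookup R v ≡ true → ∣ R ∩ inNbrs v ∣ ≡ colSum v
    ∣R∩inNbrs∣≡colSum {v} Rv = trans (∣p∣≡∑𝟙 (R ∩ inNbrs v)) (sum-cong-≗ λ u → cong 𝟙 (begin
      lookup (R ∩ inNbrs v) u               ≡⟨ lookup-zipWith _∧_ u R (inNbrs v) ⟩
      lookup R u ∧ lookup (inNbrs v) u      ≡⟨ cong (lookup R u ∧_) (lookup∘tabulate (λ u → arc D u v) u) ⟩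
      lookup R u ∧ arc D u v                ≡⟨ cong (λ b → lookup R u ∧ b ∧ arc D u v) Rv ⟨
      lookup R u ∧ lookup R v ∧ arc D u v   ∎))
      where open ≡-Reasoning

    rowSum-outside : ∀ {v} → lookup R v ≡ false → rowSum v ≡ 0
    rowSum-outside Rv rewrite Rv = sum-replicate-zero n

    ∑colSum<∑rowSum+∣R∣ : Nonempty R →
      ∑[ v < n ] colSum v < ∑[ v < n ] (𝟙 (lookup R v) + rowSum v)
    ∑colSum<∑rowSum+∣R∣ (v₀ , v₀∈R) = begin-strict
      ∑[ w < n ] ∑[ u < n ] arc𝟙 u w                      ≡⟨ ∑-comm arc𝟙 ⟨
      ∑[ u < n ] rowSum u                                  <⟨ m<n+m _ (x∈p⇒0<∣p∣ v₀∈R) ⟩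
      ∣ R ∣ + ∑[ u < n ] rowSum u                          ≡⟨ cong (_+ ∑[ u < n ] rowSum u) (∣p∣≡∑𝟙 R) ⟩
      ∑[ u < n ] 𝟙 (lookup R u) + ∑[ u < n ] rowSum u     ≡⟨ ∑-distrib-+ (𝟙 ∘ lookup R) rowSum ⟨
      ∑[ u < n ] (𝟙 (lookup R u) + rowSum u)              ∎
      where open ≤-Reasoning

    ∃-∣R∩inNbrs∣≤∣R∩outNbrs∣ : Nonempty R → ∃ λ v → v ∈ R × ∣ R ∩ inNbrs v ∣ ≤ ∣ R ∩ outNbrs D v ∣
    ∃-∣R∩inNbrs∣≤∣R∩outNbrs∣ R≢∅
      with ∑-<⇒∃-< (λ v → 𝟙 (lookup R v) + rowSum v) colSum (∑colSum<∑rowSum+∣R∣ R≢∅)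
    ... | v , col<1+row with v ∈? R
    ... | no v∉R = contradiction (subst (colSum v <_) (rowSum-outside Rv)
      (subst (λ b → colSum v < 𝟙 b + rowSum v) Rv col<1+row)) n≮0
      where Rv = x∉p⇒lookup≡false v∉R
    ... | yes v∈R = v , v∈R , subst₂ _≤_ (sym (∣R∩inNbrs∣≡colSum Rv)) (sym (∣R∩outNbrs∣≡rowSum Rv))
      (m<1+n⇒m≤n (subst (λ b → colSum v < 𝟙 b + rowSum v) Rv col<1+row))
      where Rv = []=⇒lookup v∈R

  ∈-closedOutNbhd⁺ : ∀ {S w} → w ∈ S ⊎ (∃ λ u → u ∈ S × arc D u w ≡ true) →
                     w ∈ closedOutNbhd D S
  ∈-closedOutNbhd⁺ {S} {w} (inj₁ w∈S) =
    ∈-tabulate⁺ (cong (_∨ anyFin (λ u → lookup S u ∧ arc D u w)) ([]=⇒lookup w∈S))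
  ∈-closedOutNbhd⁺ {S} {w} (inj₂ (u , u∈S , u→w)) = ∈-tabulate⁺
    (trans (cong (lookup S w ∨_) (anyFin⁺ (λ u → lookup S u ∧ arc D u w)
      (cong₂ _∧_ ([]=⇒lookup u∈S) u→w))) (∨-zeroʳ (lookup S w)))

  ∈-closedOutNbhd⁻ : ∀ {S w} → w ∈ closedOutNbhd D S →
                     w ∈ S ⊎ (∃ λ u → u ∈ S × arc D u w ≡ true)
  ∈-closedOutNbhd⁻ {S} {w} w∈ with lookup S w in Sw | ∈-tabulate⁻ w∈
  ... | true  | _   = inj₁ (lookup⇒[]= w S Sw)
  ... | false | any =
    let u , Su∧u→w = anyFin⁻ (λ u → lookup S u ∧ arc D u w) any
        Su , u→w   = ∧-≡true⁻ Su∧u→w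
    in inj₂ (u , lookup⇒[]= u S Su , u→w)

  closedOutNbhd-mono : ∀ {S T} → S ⊆ T → closedOutNbhd D S ⊆ closedOutNbhd D T
  closedOutNbhd-mono S⊆T w∈ with ∈-closedOutNbhd⁻ w∈
  ... | inj₁ w∈S              = ∈-closedOutNbhd⁺ (inj₁ (S⊆T w∈S))
  ... | inj₂ (u , u∈S , u→w) = ∈-closedOutNbhd⁺ (inj₂ (u , S⊆T u∈S , u→w))

  closedOutNbr⊆closedOutNbhd : ∀ {S v} → v ∈ S → closedOutNbr v ⊆ closedOutNbhd D S
  closedOutNbr⊆closedOutNbhd {S} {v} v∈S w∈ with x∈p∪q⁻ ⁅ v ⁆ (outNbrs D v) w∈
  ... | inj₁ w∈⁅v⁆ = ∈-closedOutNbhd⁺ (inj₁ (subst (_∈ S) (sym (x∈⁅y⁆⇒x≡y v w∈⁅v⁆)) v∈S))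
  ... | inj₂ v→w   = ∈-closedOutNbhd⁺ (inj₂ (v , v∈S , ∈-tabulate⁻ v→w))

  closedNbr : Fin n → Subset n
  closedNbr v = closedOutNbr v ∪ inNbrs v

  ∣R∩closedNbr∣≤2∣R∩closedOutNbr∣ : ∀ {R v} → ∣ R ∩ inNbrs v ∣ ≤ ∣ R ∩ outNbrs D v ∣ →
                                    ∣ R ∩ closedNbr v ∣ ≤ 2 * ∣ R ∩ closedOutNbr v ∣
  ∣R∩closedNbr∣≤2∣R∩closedOutNbr∣ {R} {v} in≤out = begin
    ∣ R ∩ closedNbr v ∣                        ≡⟨ cong ∣_∣ (∩-distribˡ-∪ R (closedOutNbr v) (inNbrs v)) ⟩
    ∣ R ∩ closedOutNbr v ∪ R ∩ inNbrs v ∣      ≤⟨ ∣p∪q∣≤∣p∣+∣q∣ (R ∩ closedOutNbr v) (R ∩ inNbrs v) ⟩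
    ∣ R ∩ closedOutNbr v ∣ + ∣ R ∩ inNbrs v ∣  ≤⟨ +-monoʳ-≤ ∣ R ∩ closedOutNbr v ∣ (≤-trans in≤out out≤) ⟩
    ∣ R ∩ closedOutNbr v ∣ + ∣ R ∩ closedOutNbr v ∣ ≡⟨ cong (∣ R ∩ closedOutNbr v ∣ +_) (+-identityʳ _) ⟨
    2 * ∣ R ∩ closedOutNbr v ∣                 ∎
    where
    open ≤-Reasoning
    out≤ : ∣ R ∩ outNbrs D v ∣ ≤ ∣ R ∩ closedOutNbr v ∣
    out≤ = p⊆q⇒∣p∣≤∣q∣ (∩-mono-⊆ {p = R} {q = outNbrs D v} id (q⊆p∪q ⁅ v ⁆ (outNbrs D v)))

  ∣R─closedNbr∩closedOutNbhd∣+∣R∩closedOutNbr∣≤ : ∀ R S v →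
    ∣ (R ─ closedNbr v) ∩ closedOutNbhd D S ∣ + ∣ R ∩ closedOutNbr v ∣ ≤
    ∣ R ∩ closedOutNbhd D (S ∪ ⁅ v ⁆) ∣
  ∣R─closedNbr∩closedOutNbhd∣+∣R∩closedOutNbr∣≤ R S v = begin
    ∣ R' ∩ closedOutNbhd D S ∣ + ∣ R ∩ closedOutNbr v ∣  ≤⟨ +-mono-≤ (p⊆q⇒∣p∣≤∣q∣ ⊆P─N⁺[v]) (p⊆q⇒∣p∣≤∣q∣ ⊆P∩N⁺[v]) ⟩
    ∣ P ─ closedOutNbr v ∣ + ∣ P ∩ closedOutNbr v ∣      ≡⟨ ∣p∣≡∣p─q∣+∣p∩q∣ P (closedOutNbr v) ⟨
    ∣ P ∣                                                ∎
    where
    open ≤-Reasoning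
    R' = R ─ closedNbr v
    P = R ∩ closedOutNbhd D (S ∪ ⁅ v ⁆)
    ⊆P─N⁺[v] : R' ∩ closedOutNbhd D S ⊆ P ─ closedOutNbr v
    ⊆P─N⁺[v] x∈ = let x∈R' , x∈N⁺[S] = x∈p∩q⁻ R' (closedOutNbhd D S) x∈ in
      x∈p∧x∉q⇒x∈p─q (x∈p∩q⁺ (p─q⊆p R (closedNbr v) x∈R' , closedOutNbhd-mono (p⊆p∪q {p = S} ⁅ v ⁆) x∈N⁺[S]))
                    (x∈p─q⇒x∉q x∈R' ∘ x∈p∪q⁺ ∘ inj₁)
    ⊆P∩N⁺[v] : R ∩ closedOutNbr v ⊆ P ∩ closedOutNbr v
    ⊆P∩N⁺[v] x∈ = let x∈R , x∈N⁺[v] = x∈p∩q⁻ R (closedOutNbr v) x∈ in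
      x∈p∩q⁺ (x∈p∩q⁺ (x∈R , closedOutNbr⊆closedOutNbhd {S ∪ ⁅ v ⁆} (x∈p∪q⁺ (inj₂ (x∈⁅x⁆ v))) x∈N⁺[v]) , x∈N⁺[v])

  Adjacent : Fin n → Fin n → Set
  Adjacent u w = arc D u w ≡ true ⊎ arc D w u ≡ true

  Dominates : Subset n → Subset n → Set
  Dominates S R = ∀ {w} → w ∈ R → w ∉ S → ∃ λ s → s ∈ S × Adjacent s w

  dominates-∪⁅⁆ : ∀ {S R v} → Dominates S (R ─ closedNbr v) → Dominates (S ∪ ⁅ v ⁆) R
  dominates-∪⁅⁆ {S} {R} {v} dom {w} w∈R w∉S⁺ with w ∈? closedNbr v
  ... | no w∉N[v] = let s , s∈S , s~w = dom (x∈p∧x∉q⇒x∈p─q w∈R w∉N[v]) (w∉S⁺ ∘ p⊆p∪q ⁅ v ⁆)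
                    in s , p⊆p∪q ⁅ v ⁆ s∈S , s~w
  ... | yes w∈N[v] with x∈p∪q⁻ (closedOutNbr v) (inNbrs v) w∈N[v]
  ... | inj₂ w→v = v , x∈p∪q⁺ (inj₂ (x∈⁅x⁆ v)) , inj₂ (∈-tabulate⁻ w→v)
  ... | inj₁ w∈N⁺[v] with x∈p∪q⁻ ⁅ v ⁆ (outNbrs D v) w∈N⁺[v]
  ... | inj₁ w∈⁅v⁆ = contradiction (x∈p∪q⁺ (inj₂ w∈⁅v⁆)) w∉S⁺
  ... | inj₂ v→w   = v , x∈p∪q⁺ (inj₂ (x∈⁅x⁆ v)) , inj₁ (∈-tabulate⁻ v→w)

  independent-∪-isolated : ∀ {S v} → Independent D S →
    (∀ {w} → w ∈ S → arc D v w ≡ false × arc D w v ≡ false) → Independent D (S ∪ ⁅ v ⁆)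
  independent-∪-isolated {S} {v} indep isolated u w u∈ w∈
    with x∈p∪⁅y⁆⁻ {p = S} u∈ | x∈p∪⁅y⁆⁻ {p = S} w∈
  ... | inj₁ u∈S  | inj₁ w∈S  = indep u w u∈S w∈S
  ... | inj₁ u∈S  | inj₂ refl = proj₂ (isolated u∈S)
  ... | inj₂ refl | inj₁ w∈S  = proj₁ (isolated w∈S)
  ... | inj₂ refl | inj₂ refl = loopless D u

  dominating⇒maximal : ∀ {S} → Independent D S → Dominates S ⊤ → MaximalIndependent D S
  dominating⇒maximal {S} indep dom = indep , λ w w∉S indep⁺ →
    let s , s∈S , s~w = dom ∈⊤ w∉S
        s∈S⁺ = x∈p∪q⁺ (inj₁ s∈S)
        w∈S⁺ = x∈p∪q⁺ (inj₂ (x∈⁅x⁆ w))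
    in case s~w of λ where
      (inj₁ s→w) → true≢false (trans (sym s→w) (indep⁺ s w s∈S⁺ w∈S⁺))
      (inj₂ w→s) → true≢false (trans (sym w→s) (indep⁺ w s w∈S⁺ s∈S⁺))

  DominatingIndependentSubset : Subset n → Set
  DominatingIndependentSubset R = Σ (Subset n) λ S →
    S ⊆ R × Independent D S × Dominates S R × ∣ R ∣ ≤ 2 * ∣ R ∩ closedOutNbhd D S ∣

  dominatingIndependentSubset : ∀ R → DominatingIndependentSubset R
  dominatingIndependentSubset = All.wfRec ⊂-wellFounded 0ℓ DominatingIndependentSubset greedy
    where
    greedy : ∀ R → (∀ {R'} → R' ⊂ R → DominatingIndependentSubset R') → DominatingIndependentSubset R
    greedy R rec with nonempty? R
    ... | no R-empty =
      ⊥ , ⊆-min R , (λ u w u∈⊥ → contradiction u∈⊥ ∉⊥) , (λ w∈R → contradiction (_ , w∈R) R-empty) ,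
      ≤-trans (≤-reflexive (Empty⇒∣p∣≡0 R-empty)) z≤n
    ... | yes R≢∅ with ∃-∣R∩inNbrs∣≤∣R∩outNbrs∣ R R≢∅
    ... | v , v∈R , in≤out
      with rec (p∩q≢∅⇒p─q⊂p R (closedNbr v) (v , x∈p∩q⁺ (v∈R , x∈p∪q⁺ (inj₁ (x∈p∪q⁺ (inj₁ (x∈⁅x⁆ v)))))))
    ... | S' , S'⊆R' , indep' , dom' , large' =
      S' ∪ ⁅ v ⁆ , p∪⁅y⁆⊆r (p─q⊆p R (closedNbr v) ∘ S'⊆R') v∈R , indep , dominates-∪⁅⁆ {R = R} {v} dom' , large
      where
      S'∉closedNbr : ∀ {w} → w ∈ S' → w ∉ closedNbr v
      S'∉closedNbr w∈S' = x∈p─q⇒x∉q (S'⊆R' w∈S')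
      indep : Independent D (S' ∪ ⁅ v ⁆)
      indep = independent-∪-isolated indep' λ w∈S' →
        x∉tabulate⇒false (S'∉closedNbr w∈S' ∘ x∈p∪q⁺ ∘ inj₁ ∘ x∈p∪q⁺ ∘ inj₂) ,
        x∉tabulate⇒false (S'∉closedNbr w∈S' ∘ x∈p∪q⁺ ∘ inj₂)
      large : ∣ R ∣ ≤ 2 * ∣ R ∩ closedOutNbhd D (S' ∪ ⁅ v ⁆) ∣
      large = begin
        ∣ R ∣                                      ≡⟨ ∣p∣≡∣p─q∣+∣p∩q∣ R (closedNbr v) ⟩
        ∣ R ─ closedNbr v ∣ + ∣ R ∩ closedNbr v ∣  ≤⟨ +-mono-≤ large' (∣R∩closedNbr∣≤2∣R∩closedOutNbr∣ {R} in≤out) ⟩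
        2 * K + 2 * M                              ≡⟨ *-distribˡ-+ 2 K M ⟨
        2 * (K + M)                                ≤⟨ *-monoʳ-≤ 2 (∣R─closedNbr∩closedOutNbhd∣+∣R∩closedOutNbr∣≤ R S' v) ⟩
        2 * ∣ R ∩ closedOutNbhd D (S' ∪ ⁅ v ⁆) ∣   ∎
        where
        open ≤-Reasoning
        K = ∣ (R ─ closedNbr v) ∩ closedOutNbhd D S' ∣
        M = ∣ R ∩ closedOutNbr v ∣

lemma4p1 : ∀ {n : ℕ} (D : Digraph n)
    → ((Δ : ℕ) → (∀ v → outdeg D v ≤ Δ)
    → Σ (Subset n) (λ A → InducedAcyclic D A × n ≤ suc Δ * ∣ A ∣))
    × Σ (Subset n) (λ S → MaximalIndependent D S × n ≤ 2 * ∣ closedOutNbhd D S ∣)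
lemma4p1 {n} D = acyclic , maximalIndependent
  where
  acyclic : (Δ : ℕ) → (∀ v → outdeg D v ≤ Δ) →
            Σ (Subset n) (λ A → InducedAcyclic D A × n ≤ suc Δ * ∣ A ∣)
  acyclic Δ bounded =
    let A , _ , ranked , large = largeRankedSubset D bounded ⊤
    in A , ranked⇒acyclic D ranked , subst (_≤ suc Δ * ∣ A ∣) (∣⊤∣≡n n) large

  maximalIndependent : Σ (Subset n) (λ S → MaximalIndependent D S × n ≤ 2 * ∣ closedOutNbhd D S ∣)
  maximalIndependent =
    let S , _ , indep , dom , large = dominatingIndependentSubset D ⊤
    in S , dominating⇒maximal D indep dom ,
       subst₂ (λ m N → m ≤ 2 * ∣ N ∣) (∣⊤∣≡n n) (∩-identityˡ (closedOutNbhd D S)) large
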